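{- For any finite simple graphs $G,H$, the strong product graph $G\boxtimes H$ is homotopic to the Cartesian simplex product $G\times H$.
   Context: For finite simple graphs $G=(V,E)$, $H=(W,F)$, the strong product $G\boxtimes H$ has vertex set $V\times W$, and distinct vertices $(a,b),(c,d)$ are adjacent iff ($a=c$ and $\{b,d\}\in F$) or ($b=d$ and $\{a,c\}\in E$) or ($\{a,c\}\in E$ and $\{b,d\}\in F$). Let $c(G)$ denote the set of complete subgraphs of $G$ (nonempty vertex subsets that are pairwise adjacent). The Cartesian simplex product $G\times H$ is the graph with vertex set $c(G)\times c(H)$ in which distinct vertices $(x,y),(a,b)$ are adjacent iff ($x\subseteq a$ and $y\subseteq b$) or ($a\subseteq x$ and $b\subseteq y$). Homotopy of graphs (Evako/Ivashchenko-type discrete homotopy): the unit sphere $S(v)$ of a vertex $v$ is the subgraph induced by the neighbors of $v$. The graph $K_1$ is contractible, and inductively a graph $G$ is contractible if it has a vertex $v$ such that both $S(v)$ and $G-v$ are contractible. A homotopy step is either the removal of a vertex $v$ whose unit sphere $S(v)$ is contractible, or the inverse operation of adding a new vertex adjacent exactly to the vertices of a contractible induced subgraph. Two graphs are homotopic if one can be transformed into a graph isomorphic to the other by a finite sequence of homotopy steps. -}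

module Defs where

open import Level using (0ℓ)
open import Data.Bool using (Bool; true; false; not; T)
open import Data.Unit using (⊤; tt)
open import Data.Empty using (⊥)
open import Data.Maybe using (Maybe; just; nothing)
import Data.Maybe.Properties as MaybeP
open import Data.Product using (Σ; Σ-syntax; _×_; _,_; proj₁; proj₂; swap)
import Data.Product.Properties as ProdP
open import Data.Sum using (_⊎_; inj₁; inj₂)
open import Data.Nat using (ℕ)
open import Data.Fin using (Fin)
import Data.Fin.Properties as FinP
import Data.Vec.Properties
import Data.Bool.Properties
open import Data.Fin.Subset using (Subset; _∈_; _⊆_; Nonempty)
open import Data.Fin.Subset.Properties using (_∈?_; _⊆?_; nonempty?)
open import Function.Bundles using (_↔_; _⇔_; Inverse; mk⇔)
open import Relation.Binary.PropositionalEquality using (_≡_; _≢_; refl; sym)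
open import Relation.Binary.Definitions using (DecidableEquality)
open import Relation.Nullary using (¬_; Dec; yes; no; ¬?)
open import Relation.Nullary.Decidable using (True; ⌊_⌋; _×-dec_; _⊎-dec_; _→-dec_)

record GraphOn (V : Set) : Set₁ where
  field
    Adj    : V → V → Set
    adj?   : ∀ x y → Dec (Adj x y)
    adj-sym : ∀ {x y} → Adj x y → Adj y x
    irrefl : ∀ {x} → ¬ Adj x x

record Graph : Set₁ where
  field
    V     : Set
    _≟_   : DecidableEquality V
    graph : GraphOn V
  open GraphOn graph public

open Graph

fin : ∀ {n} → GraphOn (Fin n) → Graph
fin {n} G = record { V = Fin n ; _≟_ = FinP._≟_ ; graph = G }

T-dec : ∀ {b} → DecidableEquality (T b)
T-dec {true} tt tt = yes refl
T-dec {false} ()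

Induced : (G : Graph) → (V G → Bool) → Graph
Induced G P = record
  { V = Σ (V G) (λ w → T (P w))
  ; _≟_ = ProdP.≡-dec (_≟_ G) T-dec
  ; graph = record
    { Adj = λ x y → Adj G (proj₁ x) (proj₁ y)
    ; adj? = λ x y → adj? G (proj₁ x) (proj₁ y)
    ; adj-sym = adj-sym G
    ; irrefl = irrefl G
    }
  }

_─_ : (G : Graph) → V G → Graph
G ─ v = Induced G (λ w → not ⌊ _≟_ G w v ⌋)

S : (G : Graph) → V G → Graph
S G v = Induced G (λ w → ⌊ adj? G v w ⌋)

addVertex : (G : Graph) → (V G → Bool) → Graph
addVertex G P = record
  { V = Maybe (V G)
  ; _≟_ = MaybeP.≡-dec (_≟_ G)
  ; graph = record { Adj = A ; adj? = a? ; adj-sym = λ {x} {y} → s {x} {y} ; irrefl = λ {x} → i {x} }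
  }
  where
  A : Maybe (V G) → Maybe (V G) → Set
  A nothing nothing = ⊥
  A nothing (just w) = T (P w)
  A (just w) nothing = T (P w)
  A (just x) (just y) = Adj G x y
  a? : ∀ x y → Dec (A x y)
  a? nothing nothing = no (λ ())
  a? nothing (just w) = T? (P w)
    where T? : ∀ b → Dec (T b)
          T? true = yes tt
          T? false = no (λ ())
  a? (just w) nothing = T? (P w)
    where T? : ∀ b → Dec (T b)
          T? true = yes tt
          T? false = no (λ ())
  a? (just x) (just y) = adj? G x y
  s : ∀ {x y} → A x y → A y x
  s {nothing} {just w} p = p
  s {just w} {nothing} p = p
  s {just x} {just y} p = adj-sym G p
  i : ∀ {x} → ¬ A x x
  i {nothing} ()
  i {just x} p = irrefl G p

record _≅_ (G H : Graph) : Set where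
  field
    bij : V G ↔ V H
    preserves : ∀ x y → Adj G x y ⇔ Adj H (Inverse.to bij x) (Inverse.to bij y)

K₁ : Graph
K₁ = record
  { V = ⊤
  ; _≟_ = λ { tt tt → yes refl }
  ; graph = record { Adj = λ _ _ → ⊥ ; adj? = λ _ _ → no (λ ()) ; adj-sym = λ () ; irrefl = λ () }
  }

-- Contractibility (Evako/Ivashchenko): K₁ is contractible; G is
-- contractible if some vertex v has S(v) and G - v contractible.

data Contractible : Graph → Set₁ where
  k₁   : ∀ {G} → G ≅ K₁ → Contractible G
  step : ∀ {G} (v : V G) → Contractible (S G v) → Contractible (G ─ v) →
         Contractible G

data HStep : Graph → Graph → Set₁ where
  remove : ∀ {G} (v : V G) → Contractible (S G v) → HStep G (G ─ v)
  add    : ∀ {G} (P : V G → Bool) → Contractible (Induced G P) →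
           HStep G (addVertex G P)

data HSteps : Graph → Graph → Set₁ where
  done : ∀ {G} → HSteps G G
  _∷_  : ∀ {G G′ K} → HStep G G′ → HSteps G′ K → HSteps G K

Homotopic : Graph → Graph → Set₁
Homotopic G H = Σ[ K ∈ Graph ] (HSteps G K × K ≅ H)


module _ {n m : ℕ} (G : GraphOn (Fin n)) (H : GraphOn (Fin m)) where
  private
    module G = GraphOn G
    module H = GraphOn H

  StrongAdj : Fin n × Fin m → Fin n × Fin m → Set
  StrongAdj (a , b) (c , d) =
    (a ≡ c × H.Adj b d) ⊎ (b ≡ d × G.Adj a c) ⊎ (G.Adj a c × H.Adj b d)

  _⊠_ : Graph
  _⊠_ = record
    { V = Fin n × Fin m
    ; _≟_ = ProdP.≡-dec FinP._≟_ FinP._≟_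
    ; graph = record
      { Adj = StrongAdj
      ; adj? = λ { (a , b) (c , d) →
          ((a FinP.≟ c) ×-dec H.adj? b d) ⊎-dec ((b FinP.≟ d) ×-dec G.adj? a c)
            ⊎-dec (G.adj? a c ×-dec H.adj? b d) }
      ; adj-sym = λ { (inj₁ (refl , f)) → inj₁ (refl , H.adj-sym f)
                ; (inj₂ (inj₁ (refl , e))) → inj₂ (inj₁ (refl , G.adj-sym e))
                ; (inj₂ (inj₂ (e , f))) → inj₂ (inj₂ (G.adj-sym e , H.adj-sym f)) }
      ; irrefl = λ { (inj₁ (_ , f)) → H.irrefl f
                   ; (inj₂ (inj₁ (_ , e))) → G.irrefl e
                   ; (inj₂ (inj₂ (e , _))) → G.irrefl e }
      }
    }

module _ {n : ℕ} (G : GraphOn (Fin n)) where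
  private module G = GraphOn G

  IsClique : Subset n → Set
  IsClique s = Nonempty s × (∀ i j → i ∈ s → j ∈ s → i ≢ j → G.Adj i j)

  isClique? : ∀ s → Dec (IsClique s)
  isClique? s = nonempty? s ×-dec
    FinP.all? (λ i → FinP.all? (λ j →
      (i ∈? s) →-dec (j ∈? s) →-dec ¬? (i FinP.≟ j) →-dec G.adj? i j))

  Clique : Set
  Clique = Σ (Subset n) (λ s → True (isClique? s))

  Clique-≟ : DecidableEquality Clique
  Clique-≟ = ProdP.≡-dec (Data.Vec.Properties.≡-dec Data.Bool.Properties._≟_) T-dec

-- Cartesian simplex product G × H on c(G) × c(H)

module _ {n m : ℕ} (G : GraphOn (Fin n)) (H : GraphOn (Fin m)) where

  SimplexAdj : Clique G × Clique H → Clique G × Clique H → Set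
  SimplexAdj p q =
    p ≢ q × ((x ⊆ a × y ⊆ b) ⊎ (a ⊆ x × b ⊆ y))
    where
    x = proj₁ (proj₁ p)
    y = proj₁ (proj₂ p)
    a = proj₁ (proj₁ q)
    b = proj₁ (proj₂ q)

  _⊗ₛ_ : Graph
  _⊗ₛ_ = record
    { V = Clique G × Clique H
    ; _≟_ = ≟′
    ; graph = record
      { Adj = SimplexAdj
      ; adj? = λ p q → ¬? (≟′ p q) ×-dec
          (((proj₁ (proj₁ p) ⊆? proj₁ (proj₁ q)) ×-dec (proj₁ (proj₂ p) ⊆? proj₁ (proj₂ q)))
          ⊎-dec ((proj₁ (proj₁ q) ⊆? proj₁ (proj₁ p)) ×-dec (proj₁ (proj₂ q) ⊆? proj₁ (proj₂ p))))
      ; adj-sym = λ { (ne , inj₁ z) → (λ e → ne (sym e)) , inj₂ z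
                ; (ne , inj₂ z) → (λ e → ne (sym e)) , inj₁ z }
      ; irrefl = λ { (ne , _) → ne refl }
      }
    }
    where
    ≟′ : DecidableEquality (Clique G × Clique H)
    ≟′ = ProdP.≡-dec (Clique-≟ G) (Clique-≟ H)

-- Work in the mixed graph whose vertices are the points of G ⊠ H and the cells c(G) × c(H):
-- points carry the strong-product edges, cells the simplex-product edges, and a point
-- (a , b) is joined to a cell (x , y) when a ∈ x and b ∈ y.  G ⊠ H and G × H are the
-- subgraphs of the mixed graph induced on the points and on the cells, so it suffices to
-- move from one to the other by homotopy steps inside it.
--
-- First add the cells in order of decreasing size.  Cells of equal size are never
-- adjacent, and when q is added its neighbours are the points of q and the larger cells
-- containing q; any point of q is adjacent to all of them, so the link is a cone.
--
-- Then remove the points one at a time.  The link of a point is contractible because,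
-- for every clique σ of G ⊠ H, the subgraph formed by the remaining common neighbours of
-- σ and the cells containing σ is contractible.  Eliminating its points one by one, the
-- link and the complement of a point x are subgraphs of the same kind, for σ ∪ {x} and
-- for σ with x discarded; once no point is left, the cells containing σ form a cone over
-- the smallest one, the product of the projections of σ.

module Submission where

open import Defs
open import Level using (0ℓ)
open import Data.Bool using (Bool; T; T?)
open import Data.Bool.Properties using (T-irrelevant)
open import Data.Empty using (⊥-elim)
open import Data.Maybe using (Maybe; just; nothing)
import Data.Maybe
open import Data.Product using (Σ; Σ-syntax; _×_; _,_; proj₁; proj₂)
open import Data.Sum using (_⊎_; inj₁; inj₂)
import Data.Sum.Properties as Sum
open import Data.Nat using (ℕ; zero; suc; _+_; _≤_; _<_; s≤s; z≤n)
import Data.Nat.Properties as ℕ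
import Data.Vec.Properties as Vec
import Data.Bool.Properties as Bool
open import Data.Fin using (Fin)
import Data.Fin.Properties as Fin
open import Data.Fin.Subset using (Subset; _∈_; _⊆_; Nonempty; ⁅_⁆; ⋃; ∣_∣; inside; outside)
open import Data.Fin.Subset.Properties
  using (_∈?_; x∈⁅x⁆; x∈⁅y⁆⇒x≡y; x∈p∪q⁻; x∈p∪q⁺; ∉⊥; drop-∷-⊆; p⊆q⇒∣p∣≤∣q∣; ∣p∣≤n)
open import Data.Vec using ([]; _∷_; here)
open import Data.List
  using (List; []; _∷_; map; _++_; concatMap; cartesianProduct; cartesianProductWith; allFin)
open import Data.List.Membership.Propositional.Properties
  using ( ∈-map⁺; ∈-map⁻; ∈-++⁺ˡ; ∈-++⁺ʳ; ∈-concatMap⁺; ∈-cartesianProductWith⁺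
        ; ∈-cartesianProduct⁺; ∈-allFin)
import Data.List.Relation.Unary.Any as Any
open import Data.List.Relation.Unary.All using (All; []; _∷_; all?)
import Data.List.Relation.Unary.All as All
open import Data.List.Membership.Propositional using () renaming (_∈_ to _∈ˡ_)
open import Data.List.Relation.Unary.Any using (here; there)
open import Relation.Binary.Construct.Closure.Reflexive using (ReflClosure; refl; [_])
open import Function using (_∘_; case_of_)
open import Function.Bundles using (Inverse; mk⇔; mk↔ₛ′; Equivalence)
open import Relation.Binary.PropositionalEquality
  using (_≡_; _≢_; refl; sym; trans; cong; cong₂; subst; subst₂)
open import Relation.Nullary using (¬_; Dec; yes; no)
open import Relation.Nullary.Decidable
  using (_×-dec_; True; ⌊_⌋; toWitness; fromWitness; toWitnessFalse; fromWitnessFalse)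
open import Relation.Unary
  using (Pred; Decidable; _∩_; _∪_; ∁; ｛_｝; _≐_; U; ∅; _⟨⊎⟩_) renaming (_⊆_ to _⊆ₚ_)
open import Relation.Unary.Properties using (_∩?_; _∪?_; ∁?; U?; ∅?; _⊎?_)

open Graph

mk≅ : ∀ {G H} (to : V G → V H) (from : V H → V G) →
  (∀ y → to (from y) ≡ y) → (∀ x → from (to x) ≡ x) →
  (∀ {x y} → Adj G x y → Adj H (to x) (to y)) →
  (∀ {x y} → Adj H (to x) (to y) → Adj G x y) → G ≅ H
mk≅ to from to-from from-to adj⁺ adj⁻ = record
  { bij = mk↔ₛ′ to from to-from from-to
  ; preserves = λ _ _ → mk⇔ adj⁺ adj⁻
  }

module Iso {G H : Graph} (f : G ≅ H) where
  open _≅_ f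
  open Inverse bij public using (to; from)
    renaming (strictlyInverseˡ to to-from; strictlyInverseʳ to from-to)

  adj⁺ : ∀ {x y} → Adj G x y → Adj H (to x) (to y)
  adj⁺ = Equivalence.to (preserves _ _)

  adj⁻ : ∀ {x y} → Adj H (to x) (to y) → Adj G x y
  adj⁻ = Equivalence.from (preserves _ _)

  from-adj : ∀ {x y} → Adj H x y → Adj G (from x) (from y)
  from-adj a = adj⁻ (subst₂ (Adj H) (sym (to-from _)) (sym (to-from _)) a)

≅-refl : ∀ {G} → G ≅ G
≅-refl = mk≅ (λ x → x) (λ x → x) (λ _ → refl) (λ _ → refl) (λ a → a) (λ a → a)

≅-sym : ∀ {G H} → G ≅ H → H ≅ G
≅-sym {H = H} f = mk≅ from to from-to to-from from-adj
  (λ a → subst₂ (Adj H) (to-from _) (to-from _) (adj⁺ a))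
  where open Iso f

≅-trans : ∀ {G H K} → G ≅ H → H ≅ K → G ≅ K
≅-trans f g = mk≅ (G.to ∘ F.to) (F.from ∘ G.from)
  (λ z → trans (cong G.to (F.to-from _)) (G.to-from z))
  (λ x → trans (cong F.from (G.from-to _)) (F.from-to x))
  (G.adj⁺ ∘ F.adj⁺) (F.adj⁻ ∘ G.adj⁻)
  where module F = Iso f
        module G = Iso g

Σ-T-≡ : ∀ {A : Set} {P : A → Bool} {a a′ : A} {p : T (P a)} {p′ : T (P a′)} →
  a ≡ a′ → _≡_ {A = Σ A (T ∘ P)} (a , p) (a′ , p′)
Σ-T-≡ {a = a} {p = p} {p′} refl = cong (a ,_) (T-irrelevant p p′)

Induced-resp-≅ : ∀ {G H} (f : G ≅ H) {P : V G → Bool} {Q : V H → Bool} →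
  (∀ {x} → T (P x) → T (Q (Iso.to f x))) → (∀ {x} → T (Q (Iso.to f x)) → T (P x)) →
  Induced G P ≅ Induced H Q
Induced-resp-≅ f {P} {Q} PQ QP = mk≅
  (λ (x , p) → to x , PQ p)
  (λ (y , q) → from y , QP (subst (T ∘ Q) (sym (to-from y)) q))
  (λ (y , _) → Σ-T-≡ (to-from y))
  (λ (x , _) → Σ-T-≡ (from-to x))
  adj⁺ adj⁻
  where open Iso f

Induced-Induced : ∀ {G} (P : V G → Bool) (Q : V (Induced G P) → Bool) (R : V G → Bool) →
  (∀ {x} (p : T (P x)) → T (Q (x , p)) → T (R x)) →
  (∀ {x} → T (R x) → Σ (T (P x)) (λ p → T (Q (x , p)))) →
  Induced (Induced G P) Q ≅ Induced G R
Induced-Induced P Q R PQ⇒R R⇒PQ = mk≅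
  (λ ((x , p) , q) → x , PQ⇒R p q)
  (λ (x , r) → (x , proj₁ (R⇒PQ r)) , proj₂ (R⇒PQ r))
  (λ _ → Σ-T-≡ refl)
  (λ _ → Σ-T-≡ (Σ-T-≡ refl))
  (λ a → a) (λ a → a)

S-resp-≅ : ∀ {G H} (f : G ≅ H) v → S G v ≅ S H (Iso.to f v)
S-resp-≅ f v = Induced-resp-≅ f (fromWitness ∘ adj⁺ ∘ toWitness) (fromWitness ∘ adj⁻ ∘ toWitness)
  where open Iso f

─-resp-≅ : ∀ {G H} (f : G ≅ H) v → (G ─ v) ≅ (H ─ Iso.to f v)
─-resp-≅ {G} {H} f v = Induced-resp-≅ f
  (λ t → fromWitnessFalse (λ e →
    toWitnessFalse t (trans (sym (from-to _)) (trans (cong from e) (from-to v)))))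
  (λ t → fromWitnessFalse (λ e → toWitnessFalse t (cong to e)))
  where open Iso f

Contractible-resp-≅ : ∀ {G H} → G ≅ H → Contractible G → Contractible H
Contractible-resp-≅ f (k₁ e) = k₁ (≅-trans (≅-sym f) e)
Contractible-resp-≅ f (step v cs cr) =
  step (Iso.to f v) (Contractible-resp-≅ (S-resp-≅ f v) cs) (Contractible-resp-≅ (─-resp-≅ f v) cr)

addVertex-resp-≅ : ∀ {G H} (f : G ≅ H) (P : V G → Bool) →
  addVertex G P ≅ addVertex H (P ∘ Iso.from f)
addVertex-resp-≅ {G} {H} f P = mk≅
  (Data.Maybe.map to) (Data.Maybe.map from)
  (λ { nothing → refl ; (just y) → cong just (to-from y) })
  (λ { nothing → refl ; (just x) → cong just (from-to x) })
  (λ {x} {y} → forth x y) (λ {x} {y} → back x y)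
  where
  open Iso f
  P-from-to : ∀ {x} → T (P x) → T (P (from (to x)))
  P-from-to = subst (T ∘ P) (sym (from-to _))
  forth : ∀ x y → Adj (addVertex G P) x y →
    Adj (addVertex H (P ∘ from)) (Data.Maybe.map to x) (Data.Maybe.map to y)
  forth nothing  (just y) p = P-from-to p
  forth (just x) nothing  p = P-from-to p
  forth (just x) (just y) a = adj⁺ a
  back : ∀ x y → Adj (addVertex H (P ∘ from)) (Data.Maybe.map to x) (Data.Maybe.map to y) →
    Adj (addVertex G P) x y
  back nothing  (just y) p = subst (T ∘ P) (from-to y) p
  back (just x) nothing  p = subst (T ∘ P) (from-to x) p
  back (just x) (just y) a = adj⁻ a

HStep-resp-≅ : ∀ {G G′ K} → G ≅ G′ → HStep G K → Σ[ K′ ∈ Graph ] (HStep G′ K′ × K ≅ K′)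
HStep-resp-≅ f (remove v c) =
  _ , remove (Iso.to f v) (Contractible-resp-≅ (S-resp-≅ f v) c) , ─-resp-≅ f v
HStep-resp-≅ {G} {G′} f (add P c) =
  _ , add (P ∘ Iso.from f) (Contractible-resp-≅ induced c) , addVertex-resp-≅ f P
  where
  induced : Induced G P ≅ Induced G′ (P ∘ Iso.from f)
  induced = Induced-resp-≅ f
    (subst (T ∘ P) (sym (Iso.from-to f _))) (subst (T ∘ P) (Iso.from-to f _))

HSteps-resp-≅ : ∀ {G G′ K} → G ≅ G′ → HSteps G K → Σ[ K′ ∈ Graph ] (HSteps G′ K′ × K ≅ K′)
HSteps-resp-≅ f done = _ , done , f
HSteps-resp-≅ f (s ∷ ss) with HStep-resp-≅ f s
... | _ , s′ , g with HSteps-resp-≅ g ss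
... | _ , ss′ , h = _ , s′ ∷ ss′ , h

_++ₕ_ : ∀ {G H K} → HSteps G H → HSteps H K → HSteps G K
done     ++ₕ ts = ts
(s ∷ ss) ++ₕ ts = s ∷ (ss ++ₕ ts)

≅⇒Homotopic : ∀ {G H} → G ≅ H → Homotopic G H
≅⇒Homotopic f = _ , done , f

Homotopic-trans : ∀ {G H K} → Homotopic G H → Homotopic H K → Homotopic G K
Homotopic-trans (_ , ss , f) (_ , ts , g) with HSteps-resp-≅ (≅-sym f) ts
... | _ , ts′ , h = _ , ss ++ₕ ts′ , ≅-trans (≅-sym h) g

∈-∷-≢ : ∀ {A : Set} {w x : A} {xs} → w ∈ˡ x ∷ xs → w ≢ x → w ∈ˡ xs
∈-∷-≢ (here w≡x) w≢x = ⊥-elim (w≢x w≡x)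
∈-∷-≢ (there w∈xs) _ = w∈xs

module Subgraphs (X : Graph) where

  Ind : {P : Pred (V X) 0ℓ} → Decidable P → Graph
  Ind P? = Induced X (λ w → ⌊ P? w ⌋)

  Ind-cong : ∀ {P Q : Pred (V X) 0ℓ} (P? : Decidable P) (Q? : Decidable Q) → P ≐ Q → Ind P? ≅ Ind Q?
  Ind-cong P? Q? (P⊆Q , Q⊆P) =
    Induced-resp-≅ (≅-refl {X}) (fromWitness ∘ P⊆Q ∘ toWitness) (fromWitness ∘ Q⊆P ∘ toWitness)

  Contractible-cong : ∀ {P Q : Pred (V X) 0ℓ} (P? : Decidable P) (Q? : Decidable Q) →
    P ≐ Q → Contractible (Ind P?) → Contractible (Ind Q?)
  Contractible-cong P? Q? = Contractible-resp-≅ ∘ Ind-cong P? Q?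

  module _ {P : Pred (V X) 0ℓ} (P? : Decidable P) where

    Ind-neighbours : ∀ v → Induced (Ind P?) (λ w → ⌊ adj? X v (proj₁ w) ⌋) ≅ Ind (P? ∩? adj? X v)
    Ind-neighbours v = Induced-Induced {X} _ _ _
      (λ p a → fromWitness (toWitness p , toWitness a))
      (λ r → fromWitness (proj₁ (toWitness r)) , fromWitness (proj₂ (toWitness r)))

    ─-Ind : ∀ {v} (p : True (P? v)) → (Ind P? ─ (v , p)) ≅ Ind (P? ∩? ∁? (_≟_ X v))
    ─-Ind p = Induced-Induced {X} _ _ _
      (λ p q → fromWitness (toWitness p , λ v≡x → toWitnessFalse q (Σ-T-≡ (sym v≡x))))
      (λ r → fromWitness (proj₁ (toWitness r)) ,
             fromWitnessFalse (λ x≡v → proj₂ (toWitness r) (sym (cong proj₁ x≡v))))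

    contractible-step : ∀ {v} → P v → Contractible (Ind (P? ∩? adj? X v)) →
      Contractible (Ind (P? ∩? ∁? (_≟_ X v))) → Contractible (Ind P?)
    contractible-step pv cS c─ = step (_ , fromWitness pv)
      (Contractible-resp-≅ (≅-sym (Ind-neighbours _)) cS) (Contractible-resp-≅ (≅-sym (─-Ind _)) c─)

    remove-homotopic : ∀ {v} → P v → Contractible (Ind (P? ∩? adj? X v)) →
      Homotopic (Ind P?) (Ind (P? ∩? ∁? (_≟_ X v)))
    remove-homotopic pv cS =
      _ , remove (_ , fromWitness pv) (Contractible-resp-≅ (≅-sym (Ind-neighbours _)) cS) ∷ done
        , ─-Ind _

    addVertex-Ind : ∀ {u} → ¬ P u →
      addVertex (Ind P?) (λ w → ⌊ adj? X u (proj₁ w) ⌋) ≅ Ind (P? ∪? _≟_ X u)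
    addVertex-Ind {u} u∉P =
      mk≅ to from to-from from-to (λ {x} {y} → forth x y) (λ {x} {y} → back x y)
      where
      to : Maybe (V (Ind P?)) → V (Ind (P? ∪? _≟_ X u))
      to nothing        = u , fromWitness (inj₂ refl)
      to (just (w , p)) = w , fromWitness (inj₁ (toWitness p))
      from-dec : ∀ w → True ((P? ∪? _≟_ X u) w) → Dec (u ≡ w) → Maybe (V (Ind P?))
      from-dec w t (yes _) = nothing
      from-dec w t (no u≢w) with toWitness t
      ... | inj₁ pw  = just (w , fromWitness pw)
      ... | inj₂ u≡w = ⊥-elim (u≢w u≡w)
      from : V (Ind (P? ∪? _≟_ X u)) → Maybe (V (Ind P?))
      from (w , t) = from-dec w t (_≟_ X u w)
      to-from-dec : ∀ w t d → to (from-dec w t d) ≡ (w , t)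
      to-from-dec w t (yes refl) = Σ-T-≡ refl
      to-from-dec w t (no u≢w) with toWitness t
      ... | inj₁ pw  = Σ-T-≡ refl
      ... | inj₂ u≡w = ⊥-elim (u≢w u≡w)
      to-from : ∀ y → to (from y) ≡ y
      to-from (w , t) = to-from-dec w t (_≟_ X u w)
      from-to-dec : ∀ x d → from-dec (proj₁ (to x)) (proj₂ (to x)) d ≡ x
      from-to-dec nothing        (yes _)   = refl
      from-to-dec nothing        (no u≢u)  = ⊥-elim (u≢u refl)
      from-to-dec (just (w , p)) (yes refl) = ⊥-elim (u∉P (toWitness p))
      from-to-dec (just (w , p)) (no u≢w) with toWitness (proj₂ (to (just (w , p))))
      ... | inj₁ _   = cong just (Σ-T-≡ refl)
      ... | inj₂ u≡w = ⊥-elim (u≢w u≡w)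
      from-to : ∀ x → from (to x) ≡ x
      from-to x = from-to-dec x (_≟_ X u (proj₁ (to x)))
      forth : ∀ x y → Adj (addVertex (Ind P?) _) x y → Adj (Ind (P? ∪? _≟_ X u)) (to x) (to y)
      forth nothing  (just _) a = toWitness a
      forth (just _) nothing  a = adj-sym X (toWitness a)
      forth (just _) (just _) a = a
      back : ∀ x y → Adj (Ind (P? ∪? _≟_ X u)) (to x) (to y) → Adj (addVertex (Ind P?) _) x y
      back nothing  nothing  a = irrefl X a
      back nothing  (just _) a = fromWitness a
      back (just _) nothing  a = fromWitness (adj-sym X a)
      back (just _) (just _) a = a

    add-homotopic : ∀ {u} → ¬ P u → Contractible (Ind (P? ∩? adj? X u)) →
      Homotopic (Ind P?) (Ind (P? ∪? _≟_ X u))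
    add-homotopic u∉P c =
      _ , add _ (Contractible-resp-≅ (≅-sym (Ind-neighbours _)) c) ∷ done , addVertex-Ind u∉P

  single-contractible : ∀ {P : Pred (V X) 0ℓ} (P? : Decidable P) {a} →
    P a → (∀ {w} → P w → w ≡ a) → Contractible (Ind P?)
  single-contractible P? {a} pa only-a = k₁ (mk≅ _ (λ _ → a , fromWitness pa) (λ _ → refl)
    (λ (_ , p) → Σ-T-≡ (sym (only-a (toWitness p))))
    (λ {(_ , p)} {(_ , q)} x~y →
      irrefl X (subst₂ (Adj X) (only-a (toWitness p)) (only-a (toWitness q)) x~y))
    (λ ()))

  cone-contractible : ∀ xs {P : Pred (V X) 0ℓ} (P? : Decidable P) {a} → P a →
    (∀ {w} → P w → w ≢ a → Adj X a w) → (∀ {w} → P w → w ≢ a → w ∈ˡ xs) →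
    Contractible (Ind P?)
  cone-contractible [] {P} P? {a} pa apex covered = single-contractible P? pa only-a
    where
    only-a : ∀ {w} → P w → w ≡ a
    only-a {w} pw with _≟_ X w a
    ... | yes w≡a = w≡a
    ... | no w≢a with covered pw w≢a
    ...   | ()
  cone-contractible (x ∷ xs) {P} P? {a} pa apex covered with P? x | _≟_ X x a
  ... | yes px | no x≢a = contractible-step P? px
    (cone-contractible xs (P? ∩? adj? X x) (pa , adj-sym X (apex px x≢a)) (apex ∘ proj₁)
      (λ (pw , x~w) w≢a → ∈-∷-≢ (covered pw w≢a) (λ { refl → irrefl X x~w })))
    (cone-contractible xs (P? ∩? ∁? (_≟_ X x)) (pa , x≢a) (apex ∘ proj₁)
      (λ (pw , x≢w) w≢a → ∈-∷-≢ (covered pw w≢a) (x≢w ∘ sym)))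
  ... | yes _ | yes x≡a = cone-contractible xs P? pa apex
    (λ pw w≢a → ∈-∷-≢ (covered pw w≢a) (λ w≡x → w≢a (trans w≡x x≡a)))
  ... | no ¬px | _ = cone-contractible xs P? pa apex
    (λ pw w≢a → ∈-∷-≢ (covered pw w≢a) (λ { refl → ¬px pw }))

  -- Adding a vertex of Q ∖ P does not change the links of the others, as none of them
  -- are adjacent.
  add-independent : ∀ xs {P Q : Pred (V X) 0ℓ} (P? : Decidable P) (Q? : Decidable Q) → P ⊆ₚ Q →
    (∀ {u} → Q u → ¬ P u → u ∈ˡ xs) →
    (∀ {u w} → Q u → ¬ P u → Q w → ¬ P w → ¬ Adj X u w) →
    (∀ {u} → Q u → ¬ P u → Contractible (Ind (P? ∩? adj? X u))) →
    Homotopic (Ind P?) (Ind Q?)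
  add-independent [] {P} {Q} P? Q? P⊆Q covered _ _ = ≅⇒Homotopic (Ind-cong P? Q? (P⊆Q , Q⊆P))
    where
    Q⊆P : Q ⊆ₚ P
    Q⊆P {u} qu with P? u
    ... | yes pu = pu
    ... | no ¬pu with covered qu ¬pu
    ...   | ()
  add-independent (x ∷ xs) {P} {Q} P? Q? P⊆Q covered independent link with Q? x | P? x
  ... | yes qx | no ¬px = Homotopic-trans (add-homotopic P? ¬px (link qx ¬px))
    (add-independent xs (P? ∪? _≟_ X x) Q? P+x⊆Q
      (λ qu ¬p+x → ∈-∷-≢ (covered qu (¬p+x ∘ inj₁)) (¬p+x ∘ inj₂ ∘ sym))
      (λ qu ¬p+u qw ¬p+w → independent qu (¬p+u ∘ inj₁) qw (¬p+w ∘ inj₁))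
      link′)
    where
    P+x⊆Q : P ∪ ｛ x ｝ ⊆ₚ Q
    P+x⊆Q (inj₁ pu)   = P⊆Q pu
    P+x⊆Q (inj₂ refl) = qx
    link′ : ∀ {u} → Q u → ¬ (P ∪ ｛ x ｝) u → Contractible (Ind ((P? ∪? _≟_ X x) ∩? adj? X u))
    link′ {u} qu ¬p+u = Contractible-cong (P? ∩? adj? X u) _
      ( (λ (pw , u~w) → inj₁ pw , u~w)
      , λ { (inj₁ pw , u~w)   → pw , u~w
          ; (inj₂ refl , u~x) → ⊥-elim (independent qu ¬pu qx ¬px u~x) })
      (link qu ¬pu)
      where
      ¬pu : ¬ P u
      ¬pu = ¬p+u ∘ inj₁
  ... | yes _ | yes px = add-independent xs P? Q? P⊆Q
    (λ qu ¬pu → ∈-∷-≢ (covered qu ¬pu) (λ { refl → ¬pu px })) independent link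
  ... | no ¬qx | _ = add-independent xs P? Q? P⊆Q
    (λ qu ¬pu → ∈-∷-≢ (covered qu ¬pu) (λ { refl → ¬qx qu })) independent link

p⊆q∧p≢q⇒∣p∣<∣q∣ : ∀ {k} {p q : Subset k} → p ⊆ q → p ≢ q → ∣ p ∣ < ∣ q ∣
p⊆q∧p≢q⇒∣p∣<∣q∣ {p = []}          {[]}          _   p≢q = ⊥-elim (p≢q refl)
p⊆q∧p≢q⇒∣p∣<∣q∣ {p = outside ∷ p} {outside ∷ q} p⊆q p≢q =
  p⊆q∧p≢q⇒∣p∣<∣q∣ (drop-∷-⊆ p⊆q) (p≢q ∘ cong (outside ∷_))
p⊆q∧p≢q⇒∣p∣<∣q∣ {p = outside ∷ p} {inside ∷ q}  p⊆q _   = s≤s (p⊆q⇒∣p∣≤∣q∣ (drop-∷-⊆ p⊆q))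
p⊆q∧p≢q⇒∣p∣<∣q∣ {p = inside ∷ p}  {outside ∷ q} p⊆q _   with p⊆q here
... | ()
p⊆q∧p≢q⇒∣p∣<∣q∣ {p = inside ∷ p}  {inside ∷ q}  p⊆q p≢q =
  s≤s (p⊆q∧p≢q⇒∣p∣<∣q∣ (drop-∷-⊆ p⊆q) (p≢q ∘ cong (inside ∷_)))

x∈⋃⁅xs⁆⁺ : ∀ {k} {i : Fin k} {is} → i ∈ˡ is → i ∈ ⋃ (map ⁅_⁆ is)
x∈⋃⁅xs⁆⁺ {is = j ∷ _} (here refl)  = x∈p∪q⁺ (inj₁ (x∈⁅x⁆ j))
x∈⋃⁅xs⁆⁺              (there i∈is) = x∈p∪q⁺ (inj₂ (x∈⋃⁅xs⁆⁺ i∈is))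

x∈⋃⁅xs⁆⁻ : ∀ {k} {i : Fin k} is → i ∈ ⋃ (map ⁅_⁆ is) → i ∈ˡ is
x∈⋃⁅xs⁆⁻ []       i∈ = ⊥-elim (∉⊥ i∈)
x∈⋃⁅xs⁆⁻ (j ∷ is) i∈ with x∈p∪q⁻ ⁅ j ⁆ _ i∈
... | inj₁ i∈⁅j⁆ = here (x∈⁅y⁆⇒x≡y j i∈⁅j⁆)
... | inj₂ i∈is  = there (x∈⋃⁅xs⁆⁻ is i∈is)

subsets : ∀ k → List (Subset k)
subsets zero    = [] ∷ []
subsets (suc k) = cartesianProductWith _∷_ (inside ∷ outside ∷ []) (subsets k)

∈-subsets : ∀ {k} (p : Subset k) → p ∈ˡ subsets k
∈-subsets []      = here refl
∈-subsets (s ∷ p) = ∈-cartesianProductWith⁺ _∷_ {xs = inside ∷ outside ∷ []} (∈-sides s) (∈-subsets p)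
  where
  ∈-sides : ∀ s → s ∈ˡ inside ∷ outside ∷ []
  ∈-sides inside  = here refl
  ∈-sides outside = there (here refl)

ReflClosure⇒ : ∀ {A : Set} {R : A → A → Set} {x y} → ReflClosure R x y → x ≢ y → R x y
ReflClosure⇒ refl  x≢x = ⊥-elim (x≢x refl)
ReflClosure⇒ [ r ] _   = r

module _ {k : ℕ} (K : GraphOn (Fin k)) where
  private module K = GraphOn K

  elems : Clique K → Subset k
  elems = proj₁

  clique-nonempty : (c : Clique K) → Nonempty (elems c)
  clique-nonempty (_ , t) = proj₁ (toWitness t)

  clique-adj⁼ : (c : Clique K) → ∀ {i j} → i ∈ elems c → j ∈ elems c → ReflClosure K.Adj i j
  clique-adj⁼ (_ , t) {i} {j} i∈c j∈c with i Fin.≟ j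
  ... | yes refl = refl
  ... | no i≢j   = [ proj₂ (toWitness t) i j i∈c j∈c i≢j ]

  clique : (s : Subset k) → Nonempty s →
    (∀ {i j} → i ∈ s → j ∈ s → ReflClosure K.Adj i j) → Clique K
  clique s ne adj⁼ = s , fromWitness (ne , λ _ _ i∈s j∈s → ReflClosure⇒ (adj⁼ i∈s j∈s))

  span : ∀ i is → (∀ {j j′} → j ∈ˡ i ∷ is → j′ ∈ˡ i ∷ is → ReflClosure K.Adj j j′) → Clique K
  span i is adj⁼ = clique (⋃ (map ⁅_⁆ (i ∷ is))) (i , x∈⋃⁅xs⁆⁺ {is = i ∷ is} (here refl))
    (λ j∈ j′∈ → adj⁼ (x∈⋃⁅xs⁆⁻ (i ∷ is) j∈) (x∈⋃⁅xs⁆⁻ (i ∷ is) j′∈))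

  private
    asClique : Subset k → List (Clique K)
    asClique s with T? ⌊ isClique? K s ⌋
    ... | yes t = (s , t) ∷ []
    ... | no _  = []

    ∈-asClique : ∀ s (t : True (isClique? K s)) → (s , t) ∈ˡ asClique s
    ∈-asClique s t with T? ⌊ isClique? K s ⌋
    ... | yes t′ = here (cong (s ,_) (T-irrelevant t t′))
    ... | no ¬t  = ⊥-elim (¬t t)

  cliques : List (Clique K)
  cliques = concatMap asClique (subsets k)

  ∈-cliques : ∀ c → c ∈ˡ cliques
  ∈-cliques (s , t) =
    ∈-concatMap⁺ asClique {xs = subsets k} (Any.map (λ { refl → ∈-asClique s t }) (∈-subsets s))

module Product {n m : ℕ} (G : GraphOn (Fin n)) (H : GraphOn (Fin m)) where
  private
    module G = GraphOn G
    module H = GraphOn H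

  Point : Set
  Point = Fin n × Fin m

  Cell : Set
  Cell = Clique G × Clique H

  ⊠-adj⁼ : ∀ {a b c d} → ReflClosure G.Adj a c → ReflClosure H.Adj b d →
    ReflClosure (Adj (G ⊠ H)) (a , b) (c , d)
  ⊠-adj⁼ refl  refl  = refl
  ⊠-adj⁼ refl  [ h ] = [ inj₁ (refl , h) ]
  ⊠-adj⁼ [ g ] refl  = [ inj₂ (inj₁ (refl , g)) ]
  ⊠-adj⁼ [ g ] [ h ] = [ inj₂ (inj₂ (g , h)) ]

  ⊠-adj⁼⁻ : ∀ {a b c d} → ReflClosure (Adj (G ⊠ H)) (a , b) (c , d) →
    ReflClosure G.Adj a c × ReflClosure H.Adj b d
  ⊠-adj⁼⁻ refl                       = refl , refl
  ⊠-adj⁼⁻ [ inj₁ (refl , h) ]        = refl , [ h ]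
  ⊠-adj⁼⁻ [ inj₂ (inj₁ (refl , g)) ] = [ g ] , refl
  ⊠-adj⁼⁻ [ inj₂ (inj₂ (g , h)) ]    = [ g ] , [ h ]

  _∈ᶜ_ : Point → Cell → Set
  (a , b) ∈ᶜ (x , y) = a ∈ elems G x × b ∈ elems H y

  _∈ᶜ?_ : ∀ o q → Dec (o ∈ᶜ q)
  (a , b) ∈ᶜ? (x , y) = (a ∈? elems G x) ×-dec (b ∈? elems H y)

  _⊑_ : Cell → Cell → Set
  (x , y) ⊑ (x′ , y′) = elems G x ⊆ elems G x′ × elems H y ⊆ elems H y′

  ⊑-∈ᶜ : ∀ {o q q′} → q ⊑ q′ → o ∈ᶜ q → o ∈ᶜ q′
  ⊑-∈ᶜ (x⊆x′ , y⊆y′) (a∈x , b∈y) = x⊆x′ a∈x , y⊆y′ b∈y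

  ∈ᶜ-adj⁼ : ∀ {o o′ q} → o ∈ᶜ q → o′ ∈ᶜ q → ReflClosure (Adj (G ⊠ H)) o o′
  ∈ᶜ-adj⁼ {q = x , y} (a∈x , b∈y) (c∈x , d∈y) =
    ⊠-adj⁼ (clique-adj⁼ G x a∈x c∈x) (clique-adj⁼ H y b∈y d∈y)

  size : Cell → ℕ
  size (x , y) = ∣ elems G x ∣ + ∣ elems H y ∣

  size≤ : ∀ q → size q ≤ n + m
  size≤ (x , y) = ℕ.+-mono-≤ (∣p∣≤n (elems G x)) (∣p∣≤n (elems H y))

  size-mono : ∀ {q q′} → q ⊑ q′ → size q ≤ size q′
  size-mono (x⊆x′ , y⊆y′) = ℕ.+-mono-≤ (p⊆q⇒∣p∣≤∣q∣ x⊆x′) (p⊆q⇒∣p∣≤∣q∣ y⊆y′)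

  size-strict : ∀ {q q′} → q ⊑ q′ → q ≢ q′ → size q < size q′
  size-strict {x , y} {x′ , y′} (x⊆x′ , y⊆y′) q≢q′
    with Vec.≡-dec Bool._≟_ (elems G x) (elems G x′) | Vec.≡-dec Bool._≟_ (elems H y) (elems H y′)
  ... | yes x≡x′ | yes y≡y′ = ⊥-elim (q≢q′ (cong₂ _,_ (Σ-T-≡ x≡x′) (Σ-T-≡ y≡y′)))
  ... | yes _    | no y≢y′  = ℕ.+-mono-≤-< (p⊆q⇒∣p∣≤∣q∣ x⊆x′) (p⊆q∧p≢q⇒∣p∣<∣q∣ y⊆y′ y≢y′)
  ... | no x≢x′  | _        = ℕ.+-mono-<-≤ (p⊆q∧p≢q⇒∣p∣<∣q∣ x⊆x′ x≢x′) (p⊆q⇒∣p∣≤∣q∣ y⊆y′)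

  adjacent-cells-differ-in-size : ∀ {q q′} → Adj (G ⊗ₛ H) q q′ → size q ≢ size q′
  adjacent-cells-differ-in-size (q≢q′ , inj₁ q⊑q′) = ℕ.<⇒≢ (size-strict q⊑q′ q≢q′)
  adjacent-cells-differ-in-size (q≢q′ , inj₂ q′⊑q) = ℕ.<⇒≢ (size-strict q′⊑q (q≢q′ ∘ sym)) ∘ sym

  MixedAdj : Point ⊎ Cell → Point ⊎ Cell → Set
  MixedAdj (inj₁ o) (inj₁ o′) = Adj (G ⊠ H) o o′
  MixedAdj (inj₁ o) (inj₂ q)  = o ∈ᶜ q
  MixedAdj (inj₂ q) (inj₁ o)  = o ∈ᶜ q
  MixedAdj (inj₂ q) (inj₂ q′) = Adj (G ⊗ₛ H) q q′

  Mixed : Graph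
  Mixed = record
    { V = Point ⊎ Cell
    ; _≟_ = Sum.≡-dec (_≟_ (G ⊠ H)) (_≟_ (G ⊗ₛ H))
    ; graph = record
      { Adj = MixedAdj
      ; adj? = λ { (inj₁ o) (inj₁ o′) → adj? (G ⊠ H) o o′
                 ; (inj₁ o) (inj₂ q)  → o ∈ᶜ? q
                 ; (inj₂ q) (inj₁ o)  → o ∈ᶜ? q
                 ; (inj₂ q) (inj₂ q′) → adj? (G ⊗ₛ H) q q′ }
      ; adj-sym = λ { {inj₁ _} {inj₁ _} → adj-sym (G ⊠ H)
                    ; {inj₁ _} {inj₂ _} o∈q → o∈q
                    ; {inj₂ _} {inj₁ _} o∈q → o∈q
                    ; {inj₂ _} {inj₂ _} → adj-sym (G ⊗ₛ H) }
      ; irrefl = λ { {inj₁ _} → irrefl (G ⊠ H) ; {inj₂ _} → irrefl (G ⊗ₛ H) }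
      }
    }

  points : List Point
  points = cartesianProduct (allFin n) (allFin m)

  ∈-points : ∀ o → o ∈ˡ points
  ∈-points (a , b) = ∈-cartesianProduct⁺ (∈-allFin a) (∈-allFin b)

  vertices : List (Point ⊎ Cell)
  vertices = map inj₁ points ++ map inj₂ (cartesianProduct (cliques G) (cliques H))

  ∈-vertices : ∀ w → w ∈ˡ vertices
  ∈-vertices (inj₁ o)       = ∈-++⁺ˡ (∈-map⁺ inj₁ (∈-points o))
  ∈-vertices (inj₂ (x , y)) =
    ∈-++⁺ʳ (map inj₁ points) (∈-map⁺ inj₂ (∈-cartesianProduct⁺ (∈-cliques G x) (∈-cliques H y)))

  open Subgraphs Mixed

  strong≅points : (G ⊠ H) ≅ Ind (U? ⊎? ∅?)
  strong≅points = mk≅ (λ o → inj₁ o , _) (λ { (inj₁ o , _) → o })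
    (λ { (inj₁ _ , _) → refl }) (λ _ → refl) (λ a → a) (λ a → a)

  cells≅simplex : Ind (∅? ⊎? U?) ≅ (G ⊗ₛ H)
  cells≅simplex = mk≅ (λ { (inj₂ q , _) → q }) (λ q → inj₂ q , _)
    (λ _ → refl) (λ { (inj₂ _ , _) → refl })
    (λ { {inj₂ _ , _} {inj₂ _ , _} a → a }) (λ { {inj₂ _ , _} {inj₂ _ , _} a → a })

  cell-link-contractible : ∀ {A : Pred Cell 0ℓ} (A? : Decidable A) q →
    (∀ {q′} → A q′ → Adj (G ⊗ₛ H) q q′ → q ⊑ q′) →
    Contractible (Ind ((U? ⊎? A?) ∩? adj? Mixed (inj₂ q)))
  cell-link-contractible {A} A? q@(x , y) above
    with (a , a∈x) ← clique-nonempty G x | (b , b∈y) ← clique-nonempty H y =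
    cone-contractible vertices _ (_ , (a∈x , b∈y)) apex (λ {w} _ _ → ∈-vertices w)
    where
    apex : ∀ {w} → ((U {A = Point} ⟨⊎⟩ A) ∩ MixedAdj (inj₂ q)) w → w ≢ inj₁ (a , b) →
      MixedAdj (inj₁ (a , b)) w
    apex {inj₁ o}  (_ , o∈q) o≢ab =
      ReflClosure⇒ (∈ᶜ-adj⁼ {q = q} (a∈x , b∈y) o∈q) (o≢ab ∘ cong inj₁ ∘ sym)
    apex {inj₂ q′} (aq′ , q~q′) _ = ⊑-∈ᶜ {a , b} {q} {q′} (above aq′ q~q′) (a∈x , b∈y)

  Large : ℕ → Pred Cell 0ℓ
  Large k q = k ≤ size q

  large? : ∀ k → Decidable (Large k)
  large? k q = k ℕ.≤? size q

  Stage : ℕ → Pred (Point ⊎ Cell) 0ℓ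
  Stage k = U ⟨⊎⟩ Large k

  stage? : ∀ k → Decidable (Stage k)
  stage? k = U? ⊎? large? k

  add-layer : ∀ k → Homotopic (Ind (stage? (suc k))) (Ind (stage? k))
  add-layer k = add-independent vertices (stage? (suc k)) (stage? k)
    (λ {w} → larger⊆large {w}) (λ {w} _ _ → ∈-vertices w)
    (λ {u} {w} → independent {u} {w}) (λ {u} → link {u})
    where
    larger⊆large : Stage (suc k) ⊆ₚ Stage k
    larger⊆large {inj₁ _} _   = _
    larger⊆large {inj₂ _} k<q = ℕ.<⇒≤ k<q
    independent : ∀ {u w} → Stage k u → ¬ Stage (suc k) u →
      Stage k w → ¬ Stage (suc k) w → ¬ MixedAdj u w
    independent {inj₁ _}           _   ¬u _   _   = ⊥-elim (¬u _)
    independent {inj₂ _} {inj₁ _}  _   _  _   ¬w  = ⊥-elim (¬w _)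
    independent {inj₂ q} {inj₂ q′} k≤q ¬u k≤q′ ¬w q~q′ = adjacent-cells-differ-in-size q~q′
      (trans (ℕ.≤-antisym (ℕ.≮⇒≥ ¬u) k≤q) (sym (ℕ.≤-antisym (ℕ.≮⇒≥ ¬w) k≤q′)))
    link : ∀ {u} → Stage k u → ¬ Stage (suc k) u →
      Contractible (Ind (stage? (suc k) ∩? adj? Mixed u))
    link {inj₁ _} _ ¬u = ⊥-elim (¬u _)
    link {inj₂ q} _ ¬u = cell-link-contractible (large? (suc k)) q (λ {q′} → above {q′})
      where
      above : ∀ {q′} → k < size q′ → Adj (G ⊗ₛ H) q q′ → q ⊑ q′
      above _    (_ , inj₁ q⊑q′) = q⊑q′
      above {q′} k<q′ (_ , inj₂ q′⊑q) = ⊥-elim (¬u (ℕ.<-≤-trans k<q′ (size-mono {q′} {q} q′⊑q)))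

  add-layers : ∀ k → Homotopic (Ind (stage? k)) (Ind (stage? 0))
  add-layers zero    = ≅⇒Homotopic ≅-refl
  add-layers (suc k) = Homotopic-trans (add-layer k) (add-layers k)

  add-cells : Homotopic (Ind (U? ⊎? ∅?)) (Ind (U? ⊎? U?))
  add-cells = Homotopic-trans (≅⇒Homotopic (Ind-cong _ _ no-cell-too-large))
    (Homotopic-trans (add-layers (suc (n + m))) (≅⇒Homotopic (Ind-cong _ _ every-cell-large)))
    where
    no-cell-too-large : (U {A = Point} ⟨⊎⟩ ∅) ≐ Stage (suc (n + m))
    no-cell-too-large = (λ { {inj₁ _} _ → _ ; {inj₂ _} () })
                      , (λ { {inj₁ _} _ → _ ; {inj₂ q} too-large → ℕ.<⇒≱ too-large (size≤ q) })
    every-cell-large : Stage 0 ≐ (U {A = Point} ⟨⊎⟩ U)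
    every-cell-large = (λ { {inj₁ _} _ → _ ; {inj₂ _} _ → _ })
                     , (λ { {inj₁ _} _ → _ ; {inj₂ _} _ → z≤n })

  CommonNeighbour : List Point → Pred Point 0ℓ
  CommonNeighbour σ o = All (λ s → Adj (G ⊠ H) s o) σ

  Contains : List Point → Pred Cell 0ℓ
  Contains σ q = All (_∈ᶜ q) σ

  Link : List Point → Pred Point 0ℓ → Pred (Point ⊎ Cell) 0ℓ
  Link σ R = (R ∩ CommonNeighbour σ) ⟨⊎⟩ Contains σ

  link? : ∀ σ {R} → Decidable R → Decidable (Link σ R)
  link? σ R? = (R? ∩? λ o → all? (λ s → adj? (G ⊠ H) s o) σ) ⊎? (λ q → all? (_∈ᶜ? q) σ)

  StrongClique : List Point → Set
  StrongClique σ = ∀ {s s′} → s ∈ˡ σ → s′ ∈ˡ σ → ReflClosure (Adj (G ⊠ H)) s s′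

  module Hull s σ (clique-σ : StrongClique (s ∷ σ)) where
    private
      first-coordinates-adj⁼ : ∀ {i i′} → i ∈ˡ map proj₁ (s ∷ σ) → i′ ∈ˡ map proj₁ (s ∷ σ) →
        ReflClosure G.Adj i i′
      first-coordinates-adj⁼ i∈ i′∈ with ∈-map⁻ proj₁ i∈ | ∈-map⁻ proj₁ i′∈
      ... | _ , t∈ , refl | _ , t′∈ , refl = proj₁ (⊠-adj⁼⁻ (clique-σ t∈ t′∈))

      second-first-coordinates-adj⁼ : ∀ {j j′} → j ∈ˡ map proj₂ (s ∷ σ) → j′ ∈ˡ map proj₂ (s ∷ σ) →
        ReflClosure H.Adj j j′
      second-first-coordinates-adj⁼ j∈ j′∈ with ∈-map⁻ proj₂ j∈ | ∈-map⁻ proj₂ j′∈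
      ... | _ , t∈ , refl | _ , t′∈ , refl = proj₂ (⊠-adj⁼⁻ (clique-σ t∈ t′∈))

    hull : Cell
    hull = span G (proj₁ s) (map proj₁ σ) first-coordinates-adj⁼
         , span H (proj₂ s) (map proj₂ σ) second-first-coordinates-adj⁼

    hull-contains : Contains (s ∷ σ) hull
    hull-contains = All.tabulate λ t∈ →
      x∈⋃⁅xs⁆⁺ (∈-map⁺ proj₁ t∈) , x∈⋃⁅xs⁆⁺ (∈-map⁺ proj₂ t∈)

    hull-least : ∀ {q} → Contains (s ∷ σ) q → hull ⊑ q
    hull-least {q} contains = x-least , y-least
      where
      x-least : elems G (proj₁ hull) ⊆ elems G (proj₁ q)
      x-least i∈ with ∈-map⁻ proj₁ (x∈⋃⁅xs⁆⁻ (map proj₁ (s ∷ σ)) i∈)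
      ... | _ , t∈ , refl = proj₁ (All.lookup contains t∈)
      y-least : elems H (proj₂ hull) ⊆ elems H (proj₂ q)
      y-least j∈ with ∈-map⁻ proj₂ (x∈⋃⁅xs⁆⁻ (map proj₂ (s ∷ σ)) j∈)
      ... | _ , t∈ , refl = proj₂ (All.lookup contains t∈)

  Link-∷ : ∀ x σ R → Link (x ∷ σ) R ≐ (Link σ R ∩ MixedAdj (inj₁ x))
  Link-∷ x σ R = (λ { {inj₁ _} (ro , x~o ∷ common) → (ro , common) , x~o
                    ; {inj₂ _} (x∈q ∷ contains)     → contains , x∈q })
               , (λ { {inj₁ _} ((ro , common) , x~o) → ro , x~o ∷ common
                    ; {inj₂ _} (contains , x∈q)     → x∈q ∷ contains })

  Link-∖ : ∀ x σ R → Link σ (R ∩ ∁ ｛ x ｝) ≐ (Link σ R ∩ ∁ ｛ inj₁ x ｝)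
  Link-∖ x σ R = (λ { {inj₁ _} ((ro , x≢o) , common) → (ro , common) , x≢o ∘ Sum.inj₁-injective
                    ; {inj₂ _} contains → contains , λ () })
               , (λ { {inj₁ _} ((ro , common) , x≢o) → (ro , x≢o ∘ cong inj₁) , common
                    ; {inj₂ _} (contains , _) → contains })

  private
    _≟ₚ_ : (o o′ : Point) → Dec (o ≡ o′)
    _≟ₚ_ = _≟_ (G ⊠ H)

    covered-∖ : ∀ {x xs} {R P : Pred Point 0ℓ} → (∀ {o} → R o → P o → o ∈ˡ x ∷ xs) →
      ∀ {o} → (R ∩ ∁ ｛ x ｝) o → P o → o ∈ˡ xs
    covered-∖ covered (ro , x≢o) po = ∈-∷-≢ (covered ro po) (x≢o ∘ sym)

  link-contractible : ∀ xs {R} (R? : Decidable R) s σ → StrongClique (s ∷ σ) →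
    (∀ {o} → R o → CommonNeighbour (s ∷ σ) o → o ∈ˡ xs) →
    Contractible (Ind (link? (s ∷ σ) R?))
  link-contractible [] {R} R? s σ clique-σ covered =
    cone-contractible vertices (link? (s ∷ σ) R?) hull-contains apex (λ {w} _ _ → ∈-vertices w)
    where
    open Hull s σ clique-σ
    apex : ∀ {w} → Link (s ∷ σ) R w → w ≢ inj₂ hull → MixedAdj (inj₂ hull) w
    apex {inj₁ o} (ro , common) _ with () ← covered ro common
    apex {inj₂ q} contains q≢hull = q≢hull ∘ cong inj₂ ∘ sym , inj₁ (hull-least {q} contains)
  link-contractible (x ∷ xs) {R} R? s σ clique-σ covered
    with (R? ∩? λ o → all? (λ t → adj? (G ⊠ H) t o) (s ∷ σ)) x
  ... | yes (rx , x~σ) = contractible-step (link? (s ∷ σ) R?) {inj₁ x} (rx , x~σ)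
    (Contractible-cong (link? (x ∷ s ∷ σ) R?) _ (Link-∷ x (s ∷ σ) R)
      (link-contractible xs R? x (s ∷ σ) clique-xσ covered-xσ))
    (Contractible-cong (link? (s ∷ σ) (R? ∩? ∁? (x ≟ₚ_))) _ (Link-∖ x (s ∷ σ) R)
      (link-contractible xs (R? ∩? ∁? (x ≟ₚ_)) s σ clique-σ (covered-∖ covered)))
    where
    clique-xσ : StrongClique (x ∷ s ∷ σ)
    clique-xσ (here refl)  (here refl)  = refl
    clique-xσ (here refl)  (there t′∈) = [ adj-sym (G ⊠ H) (All.lookup x~σ t′∈) ]
    clique-xσ (there t∈)  (here refl)  = [ All.lookup x~σ t∈ ]
    clique-xσ (there t∈)  (there t′∈) = clique-σ t∈ t′∈
    covered-xσ : ∀ {o} → R o → CommonNeighbour (x ∷ s ∷ σ) o → o ∈ˡ xs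
    covered-xσ ro (x~o ∷ common) = ∈-∷-≢ (covered ro common) λ { refl → irrefl (G ⊠ H) x~o }
  ... | no x∉link = Contractible-cong (link? (s ∷ σ) (R? ∩? ∁? (x ≟ₚ_))) _ same-link
    (link-contractible xs (R? ∩? ∁? (x ≟ₚ_)) s σ clique-σ (covered-∖ covered))
    where
    same-link : Link (s ∷ σ) (R ∩ ∁ ｛ x ｝) ≐ Link (s ∷ σ) R
    same-link = (λ { {inj₁ _} ((ro , _) , common) → ro , common ; {inj₂ _} contains → contains })
              , (λ { {inj₁ _} (ro , common) → (ro , λ { refl → x∉link (ro , common) }) , common
                   ; {inj₂ _} contains → contains })

  remove-points : ∀ xs {R} (R? : Decidable R) → (∀ {o} → R o → o ∈ˡ xs) →
    Homotopic (Ind (R? ⊎? U?)) (Ind (∅? ⊎? U?))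
  remove-points [] {R} R? covered = ≅⇒Homotopic (Ind-cong _ _ no-points)
    where
    no-points : (R ⟨⊎⟩ U {A = Cell}) ≐ (∅ ⟨⊎⟩ U {A = Cell})
    no-points = (λ { {inj₁ _} ro → case covered ro of λ () ; {inj₂ _} _ → _ })
              , (λ { {inj₁ _} () ; {inj₂ _} _ → _ })
  remove-points (x ∷ xs) {R} R? covered with R? x
  ... | yes rx = Homotopic-trans (remove-homotopic (R? ⊎? U?) {inj₁ x} rx link-of-x-contractible)
    (Homotopic-trans (≅⇒Homotopic (Ind-cong _ ((R? ∩? ∁? (x ≟ₚ_)) ⊎? U?) after-removal))
      (remove-points xs (R? ∩? ∁? (x ≟ₚ_)) (λ (ro , x≢o) → ∈-∷-≢ (covered ro) (x≢o ∘ sym))))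
    where
    link-is : Link (x ∷ []) R ≐ ((R ⟨⊎⟩ U {A = Cell}) ∩ MixedAdj (inj₁ x))
    link-is = (λ { {inj₁ _} (ro , x~o ∷ []) → ro , x~o ; {inj₂ _} (x∈q ∷ []) → _ , x∈q })
            , (λ { {inj₁ _} (ro , x~o) → ro , x~o ∷ [] ; {inj₂ _} (_ , x∈q) → x∈q ∷ [] })
    link-of-x-contractible : Contractible (Ind ((R? ⊎? U?) ∩? adj? Mixed (inj₁ x)))
    link-of-x-contractible = Contractible-cong (link? (x ∷ []) R?) _ link-is
      (link-contractible xs R? x [] (λ { (here refl) (here refl) → refl })
        (λ { ro (x~o ∷ []) → ∈-∷-≢ (covered ro) λ { refl → irrefl (G ⊠ H) x~o } }))
    after-removal : ((R ⟨⊎⟩ U {A = Cell}) ∩ ∁ ｛ inj₁ x ｝) ≐ ((R ∩ ∁ ｛ x ｝) ⟨⊎⟩ U {A = Cell})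
    after-removal = (λ { {inj₁ _} (ro , x≢o) → ro , x≢o ∘ cong inj₁ ; {inj₂ _} _ → _ })
                  , (λ { {inj₁ _} (ro , x≢o) → ro , x≢o ∘ Sum.inj₁-injective
                       ; {inj₂ _} _ → _ , λ () })
  ... | no ¬rx = remove-points xs R? (λ ro → ∈-∷-≢ (covered ro) λ { refl → ¬rx ro })

mainTheorem2 : ∀ {n m} (G : GraphOn (Fin n)) (H : GraphOn (Fin m)) →
    Homotopic (G ⊠ H) (G ⊗ₛ H)
mainTheorem2 G H =
  Homotopic-trans (≅⇒Homotopic strong≅points)
    (Homotopic-trans add-cells
      (Homotopic-trans (remove-points points U? (λ {o} _ → ∈-points o))
        (≅⇒Homotopic cells≅simplex)))
  where open Product G H
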